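{- For every integer $m>2$, the triangle (lower triangular array) with $(n,k)$-th entry $\left\langle {n \atop k}\right\rangle_m$, $0\le k\le n$, is not a row-reversed Riordan array.
   Context: An $N$-board is a linear array of $N$ unit cells. A square is a $1\times1$ tile; a $(1,m-1)$-fence is a tile consisting of two unit square posts separated by a gap of width $m-1$, whose gap may be occupied by other tiles. $\left\langle {n \atop k}\right\rangle_m$ denotes the number of tilings of an $(n+k)$-board using exactly $k$ $(1,m-1)$-fences and $n-k$ squares. For formal power series $p(x)=p_0+p_1x+\cdots$ and $q(x)=q_1x+q_2x^2+\cdots$, the row-reversed $(p,q)$ Riordan array is the lower triangular matrix with $(n,k)$-th entry $[x^n]p(x)q(x)^{n-k}$ for $0\le k\le n$; an array is a row-reversed Riordan array if it equals such a matrix for some $p,q$. -}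

module Defs where

open import Data.Nat as ℕ using (ℕ; zero; suc; _≤_; _∸_; _<ᵇ_; _≤ᵇ_; _≡ᵇ_)
open import Data.Bool using (Bool; true; false; _∧_; if_then_else_)
open import Data.List using (List; []; _∷_; length; filter; concatMap; map; upTo; foldr)
open import Data.Maybe using (Maybe; just; nothing)
open import Data.Product using (Σ; _×_; ∃)
open import Data.Integer using (+_)
open import Data.Rational using (ℚ; _/_; 0ℚ; 1ℚ; _+_; _*_)
open import Relation.Binary.PropositionalEquality using (_≡_)
open import Data.Bool.Properties using (T?)

-- Tilings of an N-board by squares and (1,m-1)-fences.
-- A tiling is recorded by labelling each of the N cells with what covers
-- it: a square (sq), the left post of a fence (lp), or the right post of
-- a fence (rp).  A fence whose left post is at cell i has its right post
-- at cell i + m (gap of width m-1).  A labelling is a valid tiling iff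
-- every lp at i has an rp at i+m and every rp at i has an lp at i-m;
-- this is a bijection with tilings.

data Cell : Set where
  sq lp rp : Cell

labellings : ℕ → List (List Cell)
labellings zero    = [] ∷ []
labellings (suc n) = concatMap (λ xs → (sq ∷ xs) ∷ (lp ∷ xs) ∷ (rp ∷ xs) ∷ []) (labellings n)

at : List Cell → ℕ → Maybe Cell
at []       _       = nothing
at (c ∷ cs) zero    = just c
at (c ∷ cs) (suc i) = at cs i

isLp : Maybe Cell → Bool
isLp (just lp) = true
isLp _         = false

isRp : Maybe Cell → Bool
isRp (just rp) = true
isRp _         = false

validAt : ℕ → List Cell → ℕ → Bool
validAt m xs i with at xs i
... | just lp = isRp (at xs (i ℕ.+ m))
... | just rp = (m ≤ᵇ i) ∧ isLp (at xs (i ∸ m))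
... | _       = true

validTiling : ℕ → List Cell → Bool
validTiling m xs = foldr (λ i b → validAt m xs i ∧ b) true (upTo (length xs))

fenceCount : List Cell → ℕ
fenceCount []        = 0
fenceCount (lp ∷ xs) = suc (fenceCount xs)
fenceCount (_  ∷ xs) = fenceCount xs

-- ⟨ n , k ⟩_m : tilings of an (n+k)-board with exactly k fences (hence n-k squares)
fenceTilings : ℕ → ℕ → ℕ → ℕ
fenceTilings m n k =
  length (filter (λ xs → T? (validTiling m xs ∧ (fenceCount xs ≡ᵇ k)))
                 (labellings (n ℕ.+ k)))

Series : Set
Series = ℕ → ℚ

sumTo : ℕ → (ℕ → ℚ) → ℚ
sumTo zero    f = f 0
sumTo (suc n) f = sumTo n f + f (suc n)

_⋆_ : Series → Series → Series
(f ⋆ g) n = sumTo n (λ i → f i * g (n ∸ i))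

oneS : Series
oneS zero    = 1ℚ
oneS (suc _) = 0ℚ

_^S_ : Series → ℕ → Series
q ^S zero  = oneS
q ^S suc j = q ⋆ (q ^S j)

toℚ : ℕ → ℚ
toℚ n = + n / 1

IsRowReversedRiordan : (ℕ → ℕ → ℚ) → Set
IsRowReversedRiordan T =
  Σ Series λ p → Σ Series λ q → (q 0 ≡ 0ℚ) ×
    (∀ n k → k ≤ n → T n k ≡ (p ⋆ (q ^S (n ∸ k))) n)

-- Power series with q₀ = 0 and q₂ = 0 satisfy q(x)^j = x^j (q₁^j + O(x²)).  If moreover
-- p₁ = 0, the coefficient of x^(j+1) in p(x) q(x)^j vanishes for every j.  For a
-- row-reversed Riordan array that coefficient is the entry (j+1, 1), and the three
-- conditions p₁ = 0, p₀ = 1, q₂ = 0 are forced by the entries (1,1), (0,0), (2,1).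
-- The fence triangle has ⟨0,0⟩ = 1 and, for m > 2, ⟨1,1⟩ = ⟨2,1⟩ = 0; but
-- ⟨m,1⟩ ≠ 0, witnessed by one fence whose gap is filled by m − 1 squares.

module Submission where

open import Defs
open import Data.Nat using (ℕ; _<_)
open import Relation.Nullary using (¬_)

open import Data.Nat as ℕ using (zero; suc; _≤_; _∸_; z≤n; s≤s; NonZero)
import Data.Nat.Properties as ℕP
open import Data.Bool using (Bool; true; _∧_; T)
open import Data.Bool.Properties using (T?; T-≡; ∧-identityʳ)
open import Function.Bundles using (Equivalence)
open import Data.Unit using (tt)
open import Data.Product using (_,_)
open import Data.List using (List; []; _∷_; length; foldr; upTo)
open import Data.List.Membership.Propositional using (_∈_)
open import Data.List.Membership.Propositional.Properties using (∈-filter⁺; ∈-concatMap⁺)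
open import Data.List.Relation.Unary.Any as Any using (here; there)
open import Data.Maybe using (just; nothing)
open import Data.Rational using (ℚ; 0ℚ; 1ℚ; _+_; _*_; Positive)
import Data.Rational.Properties as ℚP
open import Relation.Binary.Definitions using (tri<; tri≈; tri>)
open import Relation.Binary.PropositionalEquality
open ≡-Reasoning

*-vanishˡ : ∀ {a} b → a ≡ 0ℚ → a * b ≡ 0ℚ
*-vanishˡ b refl = ℚP.*-zeroˡ b

*-vanishʳ : ∀ a {b} → b ≡ 0ℚ → a * b ≡ 0ℚ
*-vanishʳ a refl = ℚP.*-zeroʳ a

sumTo-cong : ∀ n {f g : ℕ → ℚ} → (∀ i → f i ≡ g i) → sumTo n f ≡ sumTo n g
sumTo-cong zero    f≡g = f≡g 0
sumTo-cong (suc n) f≡g = cong₂ _+_ (sumTo-cong n f≡g) (f≡g (suc n))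

sumTo-zero : ∀ n (f : ℕ → ℚ) → (∀ i → i ≤ n → f i ≡ 0ℚ) → sumTo n f ≡ 0ℚ
sumTo-zero zero    f f≡0 = f≡0 0 z≤n
sumTo-zero (suc n) f f≡0 = begin
  sumTo n f + f (suc n) ≡⟨ cong₂ _+_ (sumTo-zero n f (λ i i≤n → f≡0 i (ℕP.m≤n⇒m≤1+n i≤n)))
                                     (f≡0 (suc n) ℕP.≤-refl) ⟩
  0ℚ + 0ℚ               ≡⟨ ℚP.+-identityʳ 0ℚ ⟩
  0ℚ                    ∎

⋆-identityʳ : ∀ f n → (f ⋆ oneS) n ≡ f n
⋆-identityʳ f zero    = ℚP.*-identityʳ (f 0)
⋆-identityʳ f (suc n) = begin
  sumTo n (λ i → f i * oneS (suc n ∸ i)) + f (suc n) * oneS (suc n ∸ suc n)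
    ≡⟨ cong₂ _+_ (sumTo-zero n _ (λ i i≤n → *-vanishʳ (f i) (oneS-∸ i≤n)))
                 (cong (λ t → f (suc n) * oneS t) (ℕP.n∸n≡0 n)) ⟩
  0ℚ + f (suc n) * 1ℚ
    ≡⟨ trans (ℚP.+-identityˡ _) (ℚP.*-identityʳ (f (suc n))) ⟩
  f (suc n) ∎
  where
  oneS-∸ : ∀ {i} → i ≤ n → oneS (suc n ∸ i) ≡ 0ℚ
  oneS-∸ i≤n rewrite ℕP.+-∸-assoc 1 i≤n = refl

⋆-congʳ : ∀ f {g h : Series} → (∀ n → g n ≡ h n) → ∀ n → (f ⋆ g) n ≡ (f ⋆ h) n
⋆-congʳ f g≡h n = sumTo-cong n (λ i → cong (f i *_) (g≡h (n ∸ i)))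

∸-suc-< : ∀ {n i} → suc i ≤ n → n ∸ suc i < n
∸-suc-< si≤n = ℕP.∸-monoʳ-< (s≤s z≤n) si≤n

module _ (q : Series) (q₀≡0 : q 0 ≡ 0ℚ) where

  ^S-vanishes-below : ∀ j n → n < j → (q ^S j) n ≡ 0ℚ
  ^S-vanishes-below (suc j) n (s≤s n≤j) = sumTo-zero n _ term
    where
    term : ∀ i → i ≤ n → q i * (q ^S j) (n ∸ i) ≡ 0ℚ
    term zero    _    = *-vanishˡ _ q₀≡0
    term (suc i) si≤n =
      *-vanishʳ (q (suc i)) (^S-vanishes-below j (n ∸ suc i) (ℕP.<-≤-trans (∸-suc-< si≤n) n≤j))

  module _ (q₂≡0 : q 2 ≡ 0ℚ) where

    ^S-vanishes-next : ∀ j → (q ^S j) (suc j) ≡ 0ℚ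
    ^S-vanishes-next zero    = refl
    ^S-vanishes-next (suc j) = sumTo-zero (suc (suc j)) _ term
      where
      term : ∀ i → i ≤ suc (suc j) → q i * (q ^S j) (suc (suc j) ∸ i) ≡ 0ℚ
      term 0 _ = *-vanishˡ _ q₀≡0
      term 1 _ = *-vanishʳ (q 1) (^S-vanishes-next j)
      term 2 _ = *-vanishˡ _ q₂≡0
      term (suc (suc (suc i))) (s≤s (s≤s si≤j)) =
        *-vanishʳ (q (3 ℕ.+ i)) (^S-vanishes-below j (j ∸ suc i) (∸-suc-< si≤j))

    ⋆-^S-vanishes-next : ∀ p → p 1 ≡ 0ℚ → ∀ j → (p ⋆ (q ^S j)) (suc j) ≡ 0ℚ
    ⋆-^S-vanishes-next p p₁≡0 j = sumTo-zero (suc j) _ term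
      where
      term : ∀ i → i ≤ suc j → p i * (q ^S j) (suc j ∸ i) ≡ 0ℚ
      term 0 _ = *-vanishʳ (p 0) (^S-vanishes-next j)
      term 1 _ = *-vanishˡ _ p₁≡0
      term (suc (suc i)) (s≤s si≤j) =
        *-vanishʳ (p (2 ℕ.+ i)) (^S-vanishes-below j (j ∸ suc i) (∸-suc-< si≤j))

column₁-vanishes : ∀ {T} → IsRowReversedRiordan T →
                   T 0 0 ≡ 1ℚ → T 1 1 ≡ 0ℚ → T 2 1 ≡ 0ℚ → ∀ n → T (suc n) 1 ≡ 0ℚ
column₁-vanishes {T} (p , q , q₀≡0 , T≡) T₀₀≡1 T₁₁≡0 T₂₁≡0 n = begin
  T (suc n) 1            ≡⟨ T≡ (suc n) 1 (s≤s z≤n) ⟩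
  (p ⋆ (q ^S n)) (suc n) ≡⟨ ⋆-^S-vanishes-next q q₀≡0 q₂≡0 p p₁≡0 n ⟩
  0ℚ                     ∎
  where
  p≡diagonal : ∀ n → p n ≡ T n n
  p≡diagonal n = sym (trans (T≡ n n ℕP.≤-refl)
                            (trans (cong (λ j → (p ⋆ (q ^S j)) n) (ℕP.n∸n≡0 n)) (⋆-identityʳ p n)))

  p₀≡1 : p 0 ≡ 1ℚ
  p₀≡1 = trans (p≡diagonal 0) T₀₀≡1

  p₁≡0 : p 1 ≡ 0ℚ
  p₁≡0 = trans (p≡diagonal 1) T₁₁≡0

  q₂≡0 : q 2 ≡ 0ℚ
  q₂≡0 = sym (begin
    0ℚ                                      ≡⟨ sym T₂₁≡0 ⟩
    T 2 1                                   ≡⟨ T≡ 2 1 (s≤s z≤n) ⟩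
    (p ⋆ (q ⋆ oneS)) 2                      ≡⟨ ⋆-congʳ p (⋆-identityʳ q) 2 ⟩
    (p 0 * q 2 + p 1 * q 1) + p 2 * q 0     ≡⟨ cong₂ (λ x y → (p 0 * q 2 + x) + y)
                                                     (*-vanishˡ (q 1) p₁≡0) (*-vanishʳ (p 2) q₀≡0) ⟩
    (p 0 * q 2 + 0ℚ) + 0ℚ                   ≡⟨ trans (ℚP.+-identityʳ _) (ℚP.+-identityʳ _) ⟩
    p 0 * q 2                               ≡⟨ cong (_* q 2) p₀≡1 ⟩
    1ℚ * q 2                                ≡⟨ ℚP.*-identityˡ (q 2) ⟩
    q 2                                     ∎)

toℚ-nonZero : ∀ n .{{_ : NonZero n}} → toℚ n ≢ 0ℚ
toℚ-nonZero n toℚn≡0 with subst Positive toℚn≡0 (ℚP.normalize-pos n 1)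
... | ()

∈-labellings : ∀ xs → xs ∈ labellings (length xs)
∈-labellings []       = here refl
∈-labellings (c ∷ xs) = ∈-concatMap⁺ _ (Any.map (λ { refl → cons-∈ c }) (∈-labellings xs))
  where
  cons-∈ : ∀ c → (c ∷ xs) ∈ (sq ∷ xs) ∷ (lp ∷ xs) ∷ (rp ∷ xs) ∷ []
  cons-∈ sq = here refl
  cons-∈ lp = there (here refl)
  cons-∈ rp = there (there (here refl))

validTiling-intro : ∀ m xs → (∀ i → validAt m xs i ≡ true) → validTiling m xs ≡ true
validTiling-intro m xs valid = go (upTo (length xs))
  where
  go : ∀ is → foldr (λ i b → validAt m xs i ∧ b) true is ≡ true
  go []       = refl
  go (i ∷ is) rewrite valid i = go is

squaresThenPost : ℕ → List Cell
squaresThenPost zero    = rp ∷ []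
squaresThenPost (suc b) = sq ∷ squaresThenPost b

at-squaresThenPost-< : ∀ {i b} → i < b → at (squaresThenPost b) i ≡ just sq
at-squaresThenPost-< {zero}  (s≤s _)   = refl
at-squaresThenPost-< {suc i} (s≤s i<b) = at-squaresThenPost-< i<b

at-squaresThenPost-≡ : ∀ b → at (squaresThenPost b) b ≡ just rp
at-squaresThenPost-≡ zero    = refl
at-squaresThenPost-≡ (suc b) = at-squaresThenPost-≡ b

at-squaresThenPost-> : ∀ {i b} → b < i → at (squaresThenPost b) i ≡ nothing
at-squaresThenPost-> {suc zero}    {zero}  _         = refl
at-squaresThenPost-> {suc (suc i)} {zero}  _         = refl
at-squaresThenPost-> {suc i}       {suc b} (s≤s b<i) = at-squaresThenPost-> b<i

singleFence : ℕ → List Cell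
singleFence b = lp ∷ squaresThenPost b

singleFence-valid : ∀ b → validTiling (suc b) (singleFence b) ≡ true
singleFence-valid b = validTiling-intro (suc b) (singleFence b) valid
  where
  valid : ∀ i → validAt (suc b) (singleFence b) i ≡ true
  valid zero = cong isRp (at-squaresThenPost-≡ b)
  valid (suc i) with ℕP.<-cmp i b
  ... | tri< i<b _ _ rewrite at-squaresThenPost-< i<b = refl
  ... | tri> _ _ b<i rewrite at-squaresThenPost-> b<i = refl
  ... | tri≈ _ refl _ rewrite at-squaresThenPost-≡ b | ℕP.n∸n≡0 b
                       = trans (∧-identityʳ _) (Equivalence.to T-≡ (ℕP.≤⇒≤ᵇ (ℕP.≤-refl {suc b})))

fenceCount-squaresThenPost : ∀ b → fenceCount (squaresThenPost b) ≡ 0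
fenceCount-squaresThenPost zero    = refl
fenceCount-squaresThenPost (suc b) = fenceCount-squaresThenPost b

length-squaresThenPost : ∀ b → length (squaresThenPost b) ≡ suc b
length-squaresThenPost zero    = refl
length-squaresThenPost (suc b) = cong suc (length-squaresThenPost b)

nonZero-length : ∀ {A : Set} {x : A} {xs} → x ∈ xs → NonZero (length xs)
nonZero-length {xs = _ ∷ _} _ = _

fenceTilings-single-nonZero : ∀ b → NonZero (fenceTilings (suc b) (suc b) 1)
fenceTilings-single-nonZero b = nonZero-length (∈-filter⁺ (λ xs → T? (valid xs)) ∈labellings accepted)
  where
  valid : List Cell → Bool
  valid xs = validTiling (suc b) xs ∧ (fenceCount xs ℕ.≡ᵇ 1)

  ∈labellings : singleFence b ∈ labellings (suc b ℕ.+ 1)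
  ∈labellings = subst (λ n → singleFence b ∈ labellings n)
                      (cong suc (trans (length-squaresThenPost b) (ℕP.+-comm 1 b)))
                      (∈-labellings (singleFence b))

  accepted : T (valid (singleFence b))
  accepted rewrite singleFence-valid b | fenceCount-squaresThenPost b = tt

corollary37 : (m : ℕ) → 2 < m →
    ¬ IsRowReversedRiordan (λ n k → toℚ (fenceTilings m n k))
corollary37 0             ()
corollary37 1             (s≤s ())
corollary37 2             (s≤s (s≤s ()))
corollary37 (suc (suc (suc a))) _ riordan =
  toℚ-nonZero (fenceTilings m m 1) {{fenceTilings-single-nonZero (2 ℕ.+ a)}}
    (column₁-vanishes {λ n k → toℚ (fenceTilings m n k)} riordan refl refl refl (2 ℕ.+ a))
  where
  -- the three refl's evaluate ⟨0,0⟩, ⟨1,1⟩, ⟨2,1⟩: a fence occupies m + 1 > 3 cells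
  m : ℕ
  m = 3 ℕ.+ a
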